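{- Let $X$ be a finite set with $|X|\ge 3$, let $T$ be a binary phylogenetic $X$-tree, let $\mathcal T$ be a triplet cover for $T$, and let $x\in X$. If $\mu_{\mathcal T}(x)=2$, then $\deg_{\mathcal T}(x)=1$.
   Context: A binary phylogenetic $X$-tree is an unrooted tree whose leaf set is $X$ and in which every non-leaf (interior) vertex has degree $3$; $\mathring V$ denotes the set of interior vertices. For $\mathcal T\subseteq\binom{X}{2}$ and $v\in\mathring V$, a triple $\{a,b,c\}\subseteq X$ supports $v$ if $a,b,c$ lie one in each of the three components of $T$ minus $v$ and $\{a,b\},\{a,c\},\{b,c\}\in\mathcal T$; $S_v(\mathcal T)$ is the set of triples supporting $v$. $\mathcal T$ is a triplet cover for $T$ if $S_v(\mathcal T)\neq\emptyset$ for all $v\in\mathring V$. The support graph $G(\mathcal T)$ is the bipartite graph on $X\amalg\mathring V$ with $\{x,v\}$ an edge iff $x\in A$ for all $A\in S_v(\mathcal T)$; $\deg_{\mathcal T}(x)$ is the degree of $x$ in $G(\mathcal T)$. The multiplicity $\mu_{\mathcal T}(x)$ is the number of elements of $\mathcal T$ containing $x$. -}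

module Defs where

open import Data.Nat using (ℕ; zero; suc; _+_)
open import Data.Fin using (Fin; zero; suc)
open import Data.Fin.Properties using (_≟_)
open import Data.Bool using (Bool; true; false; if_then_else_; _∧_; not)
open import Data.Sum using (_⊎_; inj₁; inj₂)
open import Data.Product using (Σ; ∃; _×_; _,_)
open import Data.List using (List; []; _∷_)
open import Data.List.Relation.Unary.All using (All)
open import Data.List.Relation.Unary.Unique.Propositional using (Unique)
open import Relation.Nullary using (¬_; does)
open import Relation.Binary.PropositionalEquality using (_≡_; _≢_)

count : ∀ {k} → (Fin k → Bool) → ℕ
count {zero}  f = 0
count {suc k} f = (if f zero then 1 else 0) + count (λ i → f (suc i))

-- Simple graphs on the vertex set  Fin n ⊎ Fin m
-- (inj₁ x : the element x of X = Fin n;  inj₂ i : the i-th non-leaf vertex)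

Vtx : ℕ → ℕ → Set
Vtx n m = Fin n ⊎ Fin m

data Walk {n m : ℕ} (adj : Vtx n m → Vtx n m → Bool) : Vtx n m → Vtx n m → Set where
  here : ∀ {u} → Walk adj u u
  step : ∀ {u w v} → adj u w ≡ true → Walk adj w v → Walk adj u v

verts : ∀ {n m} {adj : Vtx n m → Vtx n m → Bool} {u v} → Walk adj u v → List (Vtx n m)
verts {u = u} here         = u ∷ []
verts {u = u} (step _ w)   = u ∷ verts w

IsPath : ∀ {n m} {adj : Vtx n m → Vtx n m → Bool} {u v} → Walk adj u v → Set
IsPath w = Unique (verts w)

degree : ∀ {n m} → (Vtx n m → Vtx n m → Bool) → Vtx n m → ℕ
degree adj u = count (λ x → adj u (inj₁ x)) + count (λ i → adj u (inj₂ i))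

record BinaryPhyloTree (n : ℕ) : Set where
  field
    m       : ℕ
    adj     : Vtx n m → Vtx n m → Bool
    irrefl  : ∀ u → adj u u ≡ false
    sym     : ∀ u v → adj u v ≡ adj v u
    connected  : ∀ u v → Walk adj u v
    uniquePath : ∀ u v (p q : Walk adj u v) → IsPath p → IsPath q → verts p ≡ verts q
    leafDeg     : ∀ x → degree adj (inj₁ x) ≡ 1
    interiorDeg : ∀ i → degree adj (inj₂ i) ≡ 3

-- Sets of 2-element subsets of X = Fin n, given by a symmetric Bool-valued
-- relation: {a,b} ∈ 𝒯 iff a ≢ b and mem a b ≡ true.

record PairSet (n : ℕ) : Set where
  field
    mem : Fin n → Fin n → Bool
    mem-sym : ∀ a b → mem a b ≡ mem b a

_∈ᵀ_ : ∀ {n} → Fin n × Fin n → PairSet n → Set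
(a , b) ∈ᵀ 𝒯 = (a ≢ b) × (PairSet.mem 𝒯 a b ≡ true)

μ : ∀ {n} → PairSet n → Fin n → ℕ
μ 𝒯 x = count (λ y → not (does (x ≟ y)) ∧ PairSet.mem 𝒯 x y)

module _ {n : ℕ} (T : BinaryPhyloTree n) where
  open BinaryPhyloTree T

  SameComp : Fin m → Vtx n m → Vtx n m → Set
  SameComp v u w = Σ (Walk adj u w) (λ p → All (_≢ inj₂ v) (verts p))

  -- a,b,c lie in pairwise distinct components of T minus v
  -- (equivalently, since v has degree 3, one in each of the three components)
  Separates : Fin m → Fin n → Fin n → Fin n → Set
  Separates v a b c =
    ¬ SameComp v (inj₁ a) (inj₁ b) ×
    ¬ SameComp v (inj₁ a) (inj₁ c) ×
    ¬ SameComp v (inj₁ b) (inj₁ c)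

  Supports : PairSet n → Fin m → Fin n → Fin n → Fin n → Set
  Supports 𝒯 v a b c =
    Separates v a b c × ((a , b) ∈ᵀ 𝒯) × ((a , c) ∈ᵀ 𝒯) × ((b , c) ∈ᵀ 𝒯)

  TripletCover : PairSet n → Set
  TripletCover 𝒯 = ∀ v → ∃ λ a → ∃ λ b → ∃ λ c → Supports 𝒯 v a b c

  SupportEdge : PairSet n → Fin n → Fin m → Set
  SupportEdge 𝒯 x v = ∀ a b c → Supports 𝒯 v a b c → (x ≡ a) ⊎ (x ≡ b) ⊎ (x ≡ c)

  SupportDegreeOne : PairSet n → Fin n → Set
  SupportDegreeOne 𝒯 x = ∃ λ v → SupportEdge 𝒯 x v × (∀ w → SupportEdge 𝒯 x w → w ≡ v)

-- Let v be the unique neighbour of the leaf x; it is interior since |X| ≥ 3.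
-- Every triple supporting v contains x: x is alone in its component of T − v,
-- so a triple missing x would give v three neighbours besides x.  If some w ≠ v
-- were also adjacent to x in G(𝒯), a triple {x, y, z} supporting w would consist
-- of x and its only two partners y, z in 𝒯, which therefore also complete the
-- triple supporting v, so v separates y from z.  But y and z lie outside the
-- component of x in T − w, which contains v; hence the paths from w to y and to
-- z both avoid v, and so y and z are in the same component of T − v.

module Submission where

open import Defs
open import Data.Nat using (ℕ; zero; suc; _+_; _≤_; _≥_; z≤n; s≤s)
open import Data.Nat.Properties using (+-suc; 1+n≰n)
open import Data.Fin using (Fin; zero; suc)
open import Data.Fin.Properties using (_≟_; suc-injective)
open import Data.Bool using (Bool; true; false; if_then_else_; _∧_; not)
open import Data.Sum using (_⊎_; inj₁; inj₂)
open import Data.Sum.Properties using (≡-dec; inj₁-injective; inj₂-injective)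
open import Data.Product using (Σ; ∃; ∃₂; _×_; _,_)
open import Data.List using (List; []; _∷_; length)
open import Data.List.Relation.Unary.All as All using (All; []; _∷_)
open import Data.List.Relation.Unary.All.Properties using (¬Any⇒All¬)
open import Data.List.Relation.Unary.Any using (here; there)
open import Data.List.Relation.Unary.AllPairs using ([]; _∷_)
open import Data.List.Relation.Unary.Unique.Propositional using (Unique)
open import Data.List.Membership.Propositional using (_∈_)
import Data.List.Membership.DecPropositional as DecMembership
open import Data.Empty using (⊥; ⊥-elim)
open import Function using (_∘_)
open import Relation.Nullary using (¬_; does; yes; no; contradiction)
open import Relation.Binary.Definitions using (DecidableEquality)
open import Relation.Binary.PropositionalEquality
  using (_≡_; _≢_; refl; sym; trans; cong; cong₂; subst)

SwitchedOff : {A : Set} → A → (A → Bool) → (A → Bool) → Set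
SwitchedOff a f g = f a ≡ true × g a ≡ false × (∀ b → b ≢ a → g b ≡ f b)

count-cong : ∀ {k} {f g : Fin k → Bool} → (∀ i → f i ≡ g i) → count f ≡ count g
count-cong {zero}  _   = refl
count-cong {suc k} f≗g =
  cong₂ _+_ (cong (λ b → if b then 1 else 0) (f≗g zero)) (count-cong (f≗g ∘ suc))

count-switchOff : ∀ {k a} {f g : Fin k → Bool} → SwitchedOff a f g → count f ≡ suc (count g)
count-switchOff {a = zero} (fa , ga , g≗f) rewrite fa | ga =
  cong suc (count-cong (λ i → sym (g≗f (suc i) λ ())))
count-switchOff {a = suc a} {f} {g} (fa , ga , g≗f) rewrite g≗f zero (λ ()) =
  trans (cong (f₀ +_) (count-switchOff (fa , ga , λ b b≢a → g≗f (suc b) (b≢a ∘ suc-injective))))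
        (+-suc f₀ (count (g ∘ suc)))
  where
  f₀ : ℕ
  f₀ = if f zero then 1 else 0

-- degree adj u is definitionally countᵛ (adj u).
countᵛ : ∀ {n m} → (Vtx n m → Bool) → ℕ
countᵛ f = count (f ∘ inj₁) + count (f ∘ inj₂)

countᵛ-switchOff : ∀ {n m a} {f g : Vtx n m → Bool} → SwitchedOff a f g →
                   countᵛ f ≡ suc (countᵛ g)
countᵛ-switchOff {a = inj₁ a} (fa , ga , g≗f) =
  cong₂ _+_ (count-switchOff (fa , ga , λ b b≢a → g≗f (inj₁ b) (b≢a ∘ inj₁-injective)))
            (count-cong (λ i → sym (g≗f (inj₂ i) λ ())))
countᵛ-switchOff {a = inj₂ a} {g = g} (fa , ga , g≗f) =
  trans (cong₂ _+_ (count-cong (λ i → sym (g≗f (inj₁ i) λ ())))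
                   (count-switchOff (fa , ga , λ b b≢a → g≗f (inj₂ b) (b≢a ∘ inj₂-injective))))
        (+-suc (count (g ∘ inj₁)) (count (g ∘ inj₂)))

module Counting {A : Set} (_≟ᴬ_ : DecidableEquality A) (#_ : (A → Bool) → ℕ)
  (#-switchOff : ∀ {a f g} → SwitchedOff a f g → # f ≡ suc (# g)) where

  open DecMembership _≟ᴬ_ using (_∈?_)

  switchOff : A → (A → Bool) → A → Bool
  switchOff a f b = if does (b ≟ᴬ a) then false else f b

  switchOff-≢ : ∀ {a b} f → b ≢ a → switchOff a f b ≡ f b
  switchOff-≢ {a} {b} f b≢a with b ≟ᴬ a
  ... | yes b≡a = contradiction b≡a b≢a
  ... | no _    = refl

  switchOff-switchedOff : ∀ {a f} → f a ≡ true → SwitchedOff a f (switchOff a f)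
  switchOff-switchedOff {a} {f} fa = fa , off , λ b → switchOff-≢ f
    where
    off : switchOff a f a ≡ false
    off with a ≟ᴬ a
    ... | yes _   = refl
    ... | no a≢a = contradiction refl a≢a

  length≤# : ∀ f {L : List A} → Unique L → All (λ a → f a ≡ true) L → length L ≤ # f
  length≤# f {[]}    _           _         = z≤n
  length≤# f {a ∷ L} (a∉L ∷ uL) (fa ∷ fL) =
    subst (suc (length L) ≤_) (sym (#-switchOff (switchOff-switchedOff fa)))
      (s≤s (length≤# (switchOff a f) uL
        (All.zipWith (λ (a≢b , fb) → trans (switchOff-≢ f (a≢b ∘ sym)) fb) (a∉L , fL))))

  #≡length⇒∈ : ∀ f {L t} → Unique L → All (λ a → f a ≡ true) L → # f ≡ length L →
               f t ≡ true → t ∈ L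
  #≡length⇒∈ f {L} {t} uL fL #f≡ ft with t ∈? L
  ... | yes t∈L = t∈L
  ... | no  t∉L = contradiction
    (subst (suc (length L) ≤_) #f≡ (length≤# f (¬Any⇒All¬ L t∉L ∷ uL) (ft ∷ fL))) 1+n≰n

module FinCounting {k : ℕ} = Counting {Fin k} _≟_ count count-switchOff

_≟ᵛ_ : ∀ {n m} → DecidableEquality (Vtx n m)
_≟ᵛ_ = ≡-dec _≟_ _≟_

module VtxCounting {n m : ℕ} = Counting {Vtx n m} _≟ᵛ_ countᵛ countᵛ-switchOff

module _ {n m : ℕ} {adj : Vtx n m → Vtx n m → Bool} where

  Avoids : Vtx n m → ∀ {u w} → Walk adj u w → Set
  Avoids z p = All (_≢ z) (verts p)

  avoids-start : ∀ {z u w} (p : Walk adj u w) → Avoids z p → u ≢ z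
  avoids-start here       (u≢z ∷ _) = u≢z
  avoids-start (step _ _) (u≢z ∷ _) = u≢z

  _++ʷ_ : ∀ {u v w} → Walk adj u v → Walk adj v w → Walk adj u w
  here     ++ʷ q = q
  step e p ++ʷ q = step e (p ++ʷ q)

  ++ʷ-avoids : ∀ {z u v w} (p : Walk adj u v) (q : Walk adj v w) →
               Avoids z p → Avoids z q → Avoids z (p ++ʷ q)
  ++ʷ-avoids here       q _                q-avoids = q-avoids
  ++ʷ-avoids (step _ p) q (u≢z ∷ p-avoids) q-avoids =
    u≢z ∷ ++ʷ-avoids p q p-avoids q-avoids

  -- The part of p after its last visit to z.
  lastExit : ∀ {s t} z → t ≢ z → (p : Walk adj s t) →
             Avoids z p ⊎ ∃ λ u → adj z u ≡ true ×
               Σ (Walk adj u t) λ q → Avoids z q × (∀ y → Avoids y p → Avoids y q)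
  lastExit z t≢z here = inj₁ (t≢z ∷ [])
  lastExit {s} z t≢z (step e p) with lastExit z t≢z p
  ... | inj₂ (u , ezu , q , q-avoids , p⊆q) =
    inj₂ (u , ezu , q , q-avoids , λ { y (_ ∷ ps) → p⊆q y ps })
  ... | inj₁ p-avoids with s ≟ᵛ z
  ...   | yes refl = inj₂ (_ , e , p , p-avoids , λ { y (_ ∷ ps) → ps })
  ...   | no  s≢z  = inj₁ (s≢z ∷ p-avoids)

module _ {n : ℕ} (T : BinaryPhyloTree n) where
  open BinaryPhyloTree T renaming (sym to adj-sym)

  reverse : ∀ {u w} → Walk adj u w → Walk adj w u
  reverse here               = here
  reverse (step {u} {w} e p) = reverse p ++ʷ step (trans (adj-sym w u) e) here

  reverse-avoids : ∀ {z u w} (p : Walk adj u w) → Avoids z p → Avoids z (reverse p)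
  reverse-avoids here       p-avoids         = p-avoids
  reverse-avoids (step _ p) (u≢z ∷ p-avoids) =
    ++ʷ-avoids (reverse p) _ (reverse-avoids p p-avoids) (avoids-start p p-avoids ∷ u≢z ∷ [])

  SameComp-sym : ∀ {v u w} → SameComp T v u w → SameComp T v w u
  SameComp-sym (p , p-avoids) = reverse p , reverse-avoids p p-avoids

  SameComp-trans : ∀ {v u w y} → SameComp T v u w → SameComp T v w y → SameComp T v u y
  SameComp-trans (p , p-avoids) (q , q-avoids) = p ++ʷ q , ++ʷ-avoids p q p-avoids q-avoids

  unique-neighbour : ∀ {u w w'} → degree adj u ≡ 1 → adj u w ≡ true → adj u w' ≡ true → w' ≡ w
  unique-neighbour {u} deg e e' with VtxCounting.#≡length⇒∈ (adj u) ([] ∷ []) (e ∷ []) deg e'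
  ... | here w'≡w = w'≡w
  ... | there ()

  neighbour : ∀ {u w} → u ≢ w → ∃ λ u' → adj u u' ≡ true
  neighbour {u} {w} u≢w with connected u w
  ... | here     = contradiction refl u≢w
  ... | step e _ = _ , e

  leaf-edge-spans : ∀ {x y} → adj (inj₁ x) (inj₁ y) ≡ true → ∀ u → u ≡ inj₁ x ⊎ u ≡ inj₁ y
  leaf-edge-spans {x} {y} exy u = stays (inj₁ refl) (connected (inj₁ x) u)
    where
    stays : ∀ {s t} → s ≡ inj₁ x ⊎ s ≡ inj₁ y → Walk adj s t → t ≡ inj₁ x ⊎ t ≡ inj₁ y
    stays s∈xy        here       = s∈xy
    stays (inj₁ refl) (step e p) = stays (inj₂ (unique-neighbour (leafDeg x) exy e)) p
    stays (inj₂ refl) (step e p) =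
      stays (inj₁ (unique-neighbour (leafDeg y) (trans (adj-sym _ _) exy) e)) p

  interior-neighbour : (∀ a b → ∃ λ z → z ≢ a × z ≢ b) →
                       ∀ x → ∃ λ v → adj (inj₁ x) (inj₂ v) ≡ true
  interior-neighbour third x with third x x
  ... | z , z≢x , _ with neighbour {inj₁ x} {inj₁ z} (z≢x ∘ sym ∘ inj₁-injective)
  ... | inj₂ v , exv = v , exv
  ... | inj₁ y , exy with third x y
  ... | z' , z'≢x , z'≢y with leaf-edge-spans exy (inj₁ z')
  ... | inj₁ z'≡x = contradiction (inj₁-injective z'≡x) z'≢x
  ... | inj₂ z'≡y = contradiction (inj₁-injective z'≡y) z'≢y

  pendant-component : ∀ {x v u} → adj (inj₁ x) (inj₂ v) ≡ true →
                      SameComp T v (inj₁ x) u → u ≡ inj₁ x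
  pendant-component exv (here , _) = refl
  pendant-component {x} exv (step e p , _ ∷ p-avoids) =
    contradiction (unique-neighbour (leafDeg x) exv e) (avoids-start p p-avoids)

  branch : ∀ v t → ∃ λ u → adj (inj₂ v) u ≡ true × SameComp T v u (inj₁ t)
  branch v t with lastExit (inj₂ v) (λ ()) (connected (inj₂ v) (inj₁ t))
  ... | inj₁ p-avoids = contradiction refl (avoids-start (connected (inj₂ v) (inj₁ t)) p-avoids)
  ... | inj₂ (u , evu , p , p-avoids , _) = u , evu , p , p-avoids

  separated-triple-avoiding-pendant : ∀ {x v a b c} → adj (inj₁ x) (inj₂ v) ≡ true →
    Separates T v a b c → a ≢ x → b ≢ x → c ≢ x → ⊥
  separated-triple-avoiding-pendant {x} {v} {a} {b} {c} exv (a≁b , a≁c , b≁c) a≢x b≢x c≢x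
    with branch v a | branch v b | branch v c
  ... | ua , ea , ca | ub , eb , cb | uc , ec , cc =
    1+n≰n (subst (4 ≤_) (interiorDeg v)
      (VtxCounting.length≤# (adj (inj₂ v))
        ((x≠ ca a≢x ∷ x≠ cb b≢x ∷ x≠ cc c≢x ∷ []) ∷
         (apart a≁b ca cb ∷ apart a≁c ca cc ∷ []) ∷ (apart b≁c cb cc ∷ []) ∷ [] ∷ [])
        (trans (adj-sym _ _) exv ∷ ea ∷ eb ∷ ec ∷ [])))
    where
    apart : ∀ {s t u u'} → ¬ SameComp T v (inj₁ s) (inj₁ t) →
            SameComp T v u (inj₁ s) → SameComp T v u' (inj₁ t) → u ≢ u'
    apart s≁t cs ct refl = s≁t (SameComp-trans (SameComp-sym cs) ct)
    x≠ : ∀ {u t} → SameComp T v u (inj₁ t) → t ≢ x → inj₁ x ≢ u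
    x≠ c t≢x refl = t≢x (inj₁-injective (pendant-component exv c))

  pendant-in-separated-triple : ∀ {x v a b c} → adj (inj₁ x) (inj₂ v) ≡ true →
    Separates T v a b c → x ≡ a ⊎ x ≡ b ⊎ x ≡ c
  pendant-in-separated-triple {x} {a = a} {b} {c} exv sep with x ≟ a | x ≟ b | x ≟ c
  ... | yes x≡a | _       | _       = inj₁ x≡a
  ... | no _    | yes x≡b | _       = inj₂ (inj₁ x≡b)
  ... | no _    | no _    | yes x≡c = inj₂ (inj₂ x≡c)
  ... | no x≢a  | no x≢b  | no x≢c  =
    ⊥-elim (separated-triple-avoiding-pendant exv sep (x≢a ∘ sym) (x≢b ∘ sym) (x≢c ∘ sym))

  -- The walk from v into the branch of t must cross w; after its last crossing it avoids v.
  beyond : ∀ {s v w t} → adj s (inj₂ v) ≡ true → s ≢ inj₂ w → v ≢ w →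
           ¬ SameComp T w s (inj₁ t) → SameComp T v (inj₂ w) (inj₁ t)
  beyond {s} {v} {w} {t} esv s≢w v≢w s≁t with branch v t
  ... | u , evu , p , p-avoids-v with lastExit (inj₂ w) (λ ()) p
  ... | inj₁ p-avoids-w =
    contradiction (step esv (step evu p) , s≢w ∷ (v≢w ∘ inj₂-injective) ∷ p-avoids-w) s≁t
  ... | inj₂ (_ , ewu' , q , _ , p⊆q) =
    step ewu' q , (v≢w ∘ sym ∘ inj₂-injective) ∷ p⊆q (inj₂ v) p-avoids-v

  module _ (𝒯 : PairSet n) where

    ∈ᵀ-sym : ∀ {a b} → (a , b) ∈ᵀ 𝒯 → (b , a) ∈ᵀ 𝒯
    ∈ᵀ-sym {a} {b} (a≢b , ab) = a≢b ∘ sym , trans (PairSet.mem-sym 𝒯 b a) ab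

    Supports-swap₁₂ : ∀ {v a b c} → Supports T 𝒯 v a b c → Supports T 𝒯 v b a c
    Supports-swap₁₂ ((a≁b , a≁c , b≁c) , ab , ac , bc) =
      ((a≁b ∘ SameComp-sym) , b≁c , a≁c) , ∈ᵀ-sym ab , bc , ac

    Supports-swap₂₃ : ∀ {v a b c} → Supports T 𝒯 v a b c → Supports T 𝒯 v a c b
    Supports-swap₂₃ ((a≁b , a≁c , b≁c) , ab , ac , bc) =
      (a≁c , a≁b , (b≁c ∘ SameComp-sym)) , ac , ab , ∈ᵀ-sym bc

    Supports-from : ∀ {v a b c x} → Supports T 𝒯 v a b c → x ≡ a ⊎ x ≡ b ⊎ x ≡ c →
                    ∃₂ λ y z → Supports T 𝒯 v x y z
    Supports-from s (inj₁ refl)        = _ , _ , s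
    Supports-from s (inj₂ (inj₁ refl)) = _ , _ , Supports-swap₁₂ s
    Supports-from s (inj₂ (inj₂ refl)) = _ , _ , Supports-swap₁₂ (Supports-swap₂₃ s)

    partnerOf : Fin n → Fin n → Bool
    partnerOf x y = not (does (x ≟ y)) ∧ PairSet.mem 𝒯 x y

    partnerOf-∈ᵀ : ∀ {x y} → (x , y) ∈ᵀ 𝒯 → partnerOf x y ≡ true
    partnerOf-∈ᵀ {x} {y} (x≢y , xy) with x ≟ y
    ... | yes x≡y = contradiction x≡y x≢y
    ... | no _    = xy

    μ≡2⇒partner : ∀ {x y z t} → μ 𝒯 x ≡ 2 → y ≢ z → (x , y) ∈ᵀ 𝒯 → (x , z) ∈ᵀ 𝒯 →
                  (x , t) ∈ᵀ 𝒯 → t ≡ y ⊎ t ≡ z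
    μ≡2⇒partner {x} μ≡2 y≢z xy xz xt
      with FinCounting.#≡length⇒∈ (partnerOf x) ((y≢z ∷ []) ∷ [] ∷ [])
             (partnerOf-∈ᵀ xy ∷ partnerOf-∈ᵀ xz ∷ []) μ≡2 (partnerOf-∈ᵀ xt)
    ... | here t≡y          = inj₁ t≡y
    ... | there (here t≡z)  = inj₂ t≡z
    ... | there (there ())

    -- With only two partners, the two triples through x share their other two leaves.
    partners-separated : ∀ {x v w y z y' z'} → μ 𝒯 x ≡ 2 →
      Supports T 𝒯 v x y' z' → Supports T 𝒯 w x y z → ¬ SameComp T v (inj₁ y) (inj₁ z)
    partners-separated μ≡2 ((_ , _ , y'≁z') , xy' , xz' , y'≢z' , _) (_ , xy , xz , y≢z , _)
      with μ≡2⇒partner μ≡2 y≢z xy xz xy' | μ≡2⇒partner μ≡2 y≢z xy xz xz'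
    ... | inj₁ refl | inj₂ refl = y'≁z'
    ... | inj₂ refl | inj₁ refl = y'≁z' ∘ SameComp-sym
    ... | inj₁ refl | inj₁ refl = contradiction refl y'≢z'
    ... | inj₂ refl | inj₂ refl = contradiction refl y'≢z'

    support-edge-at-pendant : ∀ {x v} → adj (inj₁ x) (inj₂ v) ≡ true → SupportEdge T 𝒯 x v
    support-edge-at-pendant exv _ _ _ (sep , _) = pendant-in-separated-triple exv sep

    support-edge-only-at-pendant : ∀ {x v} → TripletCover T 𝒯 → μ 𝒯 x ≡ 2 →
      adj (inj₁ x) (inj₂ v) ≡ true → ∀ w → SupportEdge T 𝒯 x w → w ≡ v
    support-edge-only-at-pendant {v = v} cover μ≡2 exv w x~w with w ≟ v
    ... | yes w≡v = w≡v
    ... | no  w≢v with cover w | cover v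
    ... | a , b , c , s | a' , b' , c' , s'
      with Supports-from s (x~w a b c s) | Supports-from s' (support-edge-at-pendant exv a' b' c' s')
    ... | _ , _ , sw@((x≁y , x≁z , _) , _) | _ , _ , sv =
      contradiction (SameComp-trans (SameComp-sym (beyond exv (λ ()) v≢w x≁y))
                                    (beyond exv (λ ()) v≢w x≁z))
                    (partners-separated μ≡2 sv sw)
      where
      v≢w : v ≢ w
      v≢w = w≢v ∘ sym

third-element : ∀ {k} (a b : Fin (3 + k)) → ∃ λ z → z ≢ a × z ≢ b
third-element zero          zero          = suc zero , (λ ()) , (λ ())
third-element zero          (suc zero)    = suc (suc zero) , (λ ()) , (λ ())
third-element zero          (suc (suc _)) = suc zero , (λ ()) , (λ ())
third-element (suc zero)    zero          = suc (suc zero) , (λ ()) , (λ ())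
third-element (suc zero)    (suc _)       = zero , (λ ()) , (λ ())
third-element (suc (suc _)) zero          = suc zero , (λ ()) , (λ ())
third-element (suc (suc _)) (suc _)       = zero , (λ ()) , (λ ())

lemma2 : (n : ℕ) → n ≥ 3 → (T : BinaryPhyloTree n) → (𝒯 : PairSet n) →
    TripletCover T 𝒯 → (x : Fin n) → μ 𝒯 x ≡ 2 → SupportDegreeOne T 𝒯 x
lemma2 _ (s≤s (s≤s (s≤s _))) T 𝒯 cover x μ≡2 with interior-neighbour T third-element x
... | v , exv =
  v , support-edge-at-pendant T 𝒯 exv , support-edge-only-at-pendant T 𝒯 cover μ≡2 exv
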